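{- Let $A$ and $B$ be finite sets of nonempty strings over a totally ordered alphabet with $B\subseteq A$. Then $\rho(B)\leq\rho(A)$.
   Context: For a string $x=x_1\cdots x_n$, $\texttt{runs}(x)=\sum_{i=1}^{n-1}\mathbf{1}_{x_i\neq x_{i+1}}$ (and $0$ for the empty string). Every string $u$ can be written uniquely as $u=v^e$ with $v$ primitive; write $\mathrm{root}(u)=v$, $\exp(u)=e$. The $\omega$-order: $u\preceq_\omega v$ iff either $\mathrm{root}(u)=\mathrm{root}(v)$ and $\exp(u)\leq\exp(v)$, or $\mathrm{root}(u)\neq\mathrm{root}(v)$ and $u^\omega<_{\mathrm{lex}}v^\omega$. For a multiset $W$ of nonempty strings, $\texttt{ebwt}(W)$ is obtained by listing all circular rotations of all strings of $W$ (one per position of each string, with multiplicity), sorting them in ascending $\omega$-order, and concatenating their last characters. $\rho(W)=\texttt{runs}(\texttt{ebwt}(W))$. -}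

module Defs where

open import Level using (Level; _⊔_)
open import Data.Nat using (ℕ; zero; suc; _<_; _≤_; _+_; _%_)
open import Data.Nat.DivMod using (m%n<n)
open import Data.Fin using (fromℕ<)
open import Data.List using (List; []; _∷_; length; lookup; concat; concatMap; replicate; take; drop; map; applyUpTo)
open import Data.List.Relation.Unary.AllPairs using (AllPairs)
open import Data.List.Relation.Binary.Permutation.Propositional using (_↭_)
open import Data.Product using (Σ; _×_; ∃; ∃-syntax)
open import Data.Sum using (_⊎_)
open import Data.Empty using (⊥)
open import Relation.Nullary using (¬_; yes; no; does)
open import Data.Bool using (if_then_else_)
open import Relation.Binary.Core using (Rel)
open import Relation.Binary.Structures using (IsStrictTotalOrder)
open import Relation.Binary.PropositionalEquality using (_≡_)

module Alphabet {a ℓ : Level} {A : Set a} {_<_ : Rel A ℓ}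
                (sto : IsStrictTotalOrder _≡_ _<_) where

  open IsStrictTotalOrder sto using (_≟_)

  runsFrom : A → List A → ℕ
  runsFrom x []      = 0
  runsFrom x (y ∷ r) = (if does (x ≟ y) then 0 else 1) + runsFrom y r

  runs : List A → ℕ
  runs []      = 0
  runs (x ∷ r) = runsFrom x r

  pow : List A → ℕ → List A
  pow v e = concat (replicate e v)

  Primitive : List A → Set a
  Primitive v = ¬ (v ≡ []) × (∀ (w : List A) (k : ℕ) → v ≡ pow w k → k ≡ 1)

  RootExp : List A → List A → ℕ → Set a
  RootExp u v e = Primitive v × u ≡ pow v e

  omega : A → List A → ℕ → A
  omega x xs i = lookup (x ∷ xs) (fromℕ< (m%n<n i (suc (length xs))))

  LexLt : (ℕ → A) → (ℕ → A) → Set (a ⊔ ℓ)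
  LexLt f g = ∃[ k ] ((∀ j → j Data.Nat.< k → f j ≡ g j) × (f k < g k))

  -- u^ω <lex v^ω (only meaningful for nonempty u, v)
  OmegaLt : List A → List A → Set (a ⊔ ℓ)
  OmegaLt []       _        = Level.Lift (a ⊔ ℓ) ⊥
  OmegaLt (_ ∷ _)  []       = Level.Lift (a ⊔ ℓ) ⊥
  OmegaLt (x ∷ xs) (y ∷ ys) = LexLt (omega x xs) (omega y ys)

  _⪯ω_ : List A → List A → Set (a ⊔ ℓ)
  u ⪯ω v =
      (∃[ r ] ∃[ e ] ∃[ f ] (RootExp u r e × RootExp v r f × e ≤ f))
    ⊎ (∃[ r ] ∃[ s ] ∃[ e ] ∃[ f ]
         (RootExp u r e × RootExp v s f × ¬ (r ≡ s) × OmegaLt u v))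

  rotations : List A → List (List A)
  rotations w = applyUpTo (λ i → drop i w ++ take i w) (length w)
    where open Data.List using (_++_)

  -- multiset of all rotations of all strings of W (with multiplicity)
  allRotations : List (List A) → List (List A)
  allRotations W = concatMap rotations W

  lastChar : List A → List A
  lastChar []           = []
  lastChar (x ∷ [])     = x ∷ []
  lastChar (x ∷ y ∷ r)  = lastChar (y ∷ r)

  IsEBWT : List (List A) → List A → Set (a ⊔ ℓ)
  IsEBWT W e = ∃[ L ] (L ↭ allRotations W × AllPairs _⪯ω_ L × e ≡ concatMap lastChar L)

{-# OPTIONS --safe #-}
module Submission where

-- The rotations of the strings of B form a sub-multiset of those of A. The
-- ω-order is antisymmetric on strings, so a sorted list contains every sorted
-- sub-multiset of its elements as a subsequence; hence ebwt(B) is a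
-- subsequence of ebwt(A). Deleting letters never creates a new run, because
-- "x ≠ z" implies "x ≠ y or y ≠ z".

open import Defs
open import Level using (Level)
open import Data.Nat using (ℕ; zero; suc; _+_; _*_; _≤_; _<_; _%_; z≤n; s≤s)
open import Data.Nat.Properties
  using (≤-refl; ≤-trans; ≤-antisym; +-assoc; +-comm; +-monoˡ-≤; +-monoʳ-≤;
         m≤n+m; ≮⇒≥; _<?_; <-cmp; +-cancelˡ-<; *-monoˡ-≤; *-cancelʳ-≡; m≤n⇒∃[o]m+o≡n; module ≤-Reasoning)
open import Data.Nat.DivMod using (m%n<n; m<n⇒m%n≡m; [m+n]%n≡m%n; m∣n⇒o%n%m≡o%m)
open import Data.Nat.Divisibility using (divides)
open import Data.Fin using (Fin; toℕ; fromℕ<)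
import Data.Fin as Fin
open import Data.Fin.Properties using (toℕ-fromℕ<)
open import Data.Maybe using (Maybe; just; nothing)
open import Data.Maybe.Properties using (just-injective)
open import Data.List using (List; []; _∷_; _++_; [_]; length; lookup; concatMap)
open import Data.List.Properties using (length-++; ++-assoc; concatMap-++)
open import Data.List.Relation.Unary.All as All using (All)
open import Data.List.Relation.Unary.Any using (here; there)
open import Data.List.Relation.Unary.AllPairs using (AllPairs; _∷_)
open import Data.List.Relation.Unary.Unique.Propositional using (Unique)
open import Data.List.Membership.Propositional using (_∈_)
open import Data.List.Membership.Propositional.Properties using (∈-∃++; ∈-++⁻)
open import Data.List.Relation.Binary.Permutation.Propositional as ↭
  using (_↭_; prep; swap; ↭-refl; ↭-sym; ↭-trans; module PermutationReasoning)
open import Data.List.Relation.Binary.Permutation.Propositional.Properties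
  using (∈-resp-↭; ↭-length; ++⁺ˡ; ++⁺ʳ; shift; shifts; drop-∷)
open import Data.List.Relation.Binary.Sublist.Propositional
  using (_⊆_; _∷_; _∷ʳ_; []; minimum; ⊆-reflexive)
import Data.List.Relation.Binary.Sublist.Heterogeneous as Sublist
open import Data.List.Relation.Binary.Sublist.Propositional.Properties
  using (concat⁺) renaming (map⁺ to map⁺-⊆)
open import Data.Product using (∃; _,_)
open import Data.Sum using (inj₁; inj₂)
open import Data.Empty using (⊥-elim)
open import Relation.Nullary using (¬_; yes; no; does)
open import Data.Bool using (if_then_else_)
open import Relation.Binary.Core using (Rel)
open import Relation.Binary.Definitions using (tri<; tri≈; tri>)
open import Relation.Binary.Structures using (IsStrictTotalOrder)
open import Relation.Binary.PropositionalEquality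
  using (_≡_; refl; sym; trans; cong; subst; module ≡-Reasoning)

module _ {x} {X : Set x} where

  shift-++ : ∀ (v : X) xs ys zs → xs ++ ys ++ [ v ] ++ zs ↭ v ∷ xs ++ ys ++ zs
  shift-++ v xs ys zs = begin
    xs ++ ys ++ [ v ] ++ zs    ≡⟨ ++-assoc xs ys _ ⟨
    (xs ++ ys) ++ [ v ] ++ zs  ↭⟨ shift v (xs ++ ys) zs ⟩
    v ∷ (xs ++ ys) ++ zs       ≡⟨ cong (v ∷_) (++-assoc xs ys zs) ⟩
    v ∷ xs ++ ys ++ zs         ∎
    where open PermutationReasoning

  Unique-⊆⇒↭-++ : ∀ {xs ys : List X} → Unique ys → (∀ w → w ∈ ys → w ∈ xs) →
                  ∃ λ zs → xs ↭ ys ++ zs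
  Unique-⊆⇒↭-++ {xs} {[]} _ _ = xs , ↭-refl
  Unique-⊆⇒↭-++ {xs} {y ∷ ys} (y∉ys ∷ ys!) ys⊆xs
    with zs , xs↭ ← Unique-⊆⇒↭-++ ys! (λ w w∈ys → ys⊆xs w (there w∈ys))
    with ∈-++⁻ ys (∈-resp-↭ xs↭ (ys⊆xs y (here refl)))
  ... | inj₁ y∈ys = ⊥-elim (All.lookup y∉ys y∈ys refl)
  ... | inj₂ y∈zs with h , t , refl ← ∈-∃++ y∈zs = h ++ t , ↭-trans xs↭ (shift-++ y ys h t)

  module _ {r} {R : Rel X r} (antisym : ∀ {u v} → R u v → R v u → u ≡ v) where

    AllPairs-↭-++⇒⊆ : ∀ {xs ys zs} → AllPairs R xs → AllPairs R ys → xs ↭ ys ++ zs → ys ⊆ xs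
    AllPairs-↭-++⇒⊆ {xs} {[]} _ _ _ = minimum xs
    AllPairs-↭-++⇒⊆ {[]} {y ∷ ys} _ _ p with () ← ↭-length p
    AllPairs-↭-++⇒⊆ {x ∷ xs} {y ∷ ys} (x≤xs ∷ xs↑) (y≤ys ∷ ys↑) p
      with ∈-++⁻ (y ∷ ys) (∈-resp-↭ p (here refl))
    ... | inj₁ (here refl) = refl ∷ AllPairs-↭-++⇒⊆ xs↑ ys↑ (drop-∷ p)
    ... | inj₂ x∈zs with h , t , refl ← ∈-∃++ x∈zs =
      x ∷ʳ AllPairs-↭-++⇒⊆ xs↑ (y≤ys ∷ ys↑) (drop-∷ (↭-trans p (shift-++ x (y ∷ ys) h t)))
    ... | inj₁ (there x∈ys) with ∈-resp-↭ (↭-sym p) (here refl)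
    ...   | here refl = refl ∷ AllPairs-↭-++⇒⊆ xs↑ ys↑ (drop-∷ p)
    ...   | there y∈xs with refl ← antisym (All.lookup x≤xs y∈xs) (All.lookup y≤ys x∈ys) =
      refl ∷ AllPairs-↭-++⇒⊆ xs↑ ys↑ (drop-∷ p)

  nth : List X → ℕ → Maybe X
  nth [] _ = nothing
  nth (x ∷ xs) zero = just x
  nth (x ∷ xs) (suc i) = nth xs i

  nth-lookup : ∀ xs (i : Fin (length xs)) → nth xs (toℕ i) ≡ just (lookup xs i)
  nth-lookup (x ∷ xs) Fin.zero = refl
  nth-lookup (x ∷ xs) (Fin.suc i) = nth-lookup xs i

  nth-++ˡ : ∀ xs ys {i} → i < length xs → nth (xs ++ ys) i ≡ nth xs i
  nth-++ˡ (x ∷ xs) ys {zero} _ = refl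
  nth-++ˡ (x ∷ xs) ys {suc i} (s≤s i<) = nth-++ˡ xs ys i<

  nth-++ʳ : ∀ xs ys i → nth (xs ++ ys) (length xs + i) ≡ nth ys i
  nth-++ʳ [] ys i = refl
  nth-++ʳ (x ∷ xs) ys i = nth-++ʳ xs ys i

module _ {x y} {X : Set x} {Y : Set y} (f : X → List Y) where

  concatMap-↭ : ∀ {xs ys} → xs ↭ ys → concatMap f xs ↭ concatMap f ys
  concatMap-↭ ↭.refl = ↭-refl
  concatMap-↭ (prep x p) = ++⁺ˡ (f x) (concatMap-↭ p)
  concatMap-↭ (swap x y p) =
    ↭-trans (shifts (f x) (f y)) (++⁺ˡ (f y) (++⁺ˡ (f x) (concatMap-↭ p)))
  concatMap-↭ (↭.trans p q) = ↭-trans (concatMap-↭ p) (concatMap-↭ q)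

  concatMap-⊆ : ∀ {xs ys} → xs ⊆ ys → concatMap f xs ⊆ concatMap f ys
  concatMap-⊆ p = concat⁺ (Sublist.map ⊆-reflexive (map⁺-⊆ f p))

module _ {a ℓ} {A : Set a} {_≺_ : Rel A ℓ} (sto : IsStrictTotalOrder _≡_ _≺_) where

  open Alphabet sto
  open IsStrictTotalOrder sto using (_≟_; irrefl; asym)

  change : A → A → ℕ
  change x y = if does (x ≟ y) then 0 else 1

  change-triangle : ∀ x y z → change x z ≤ change x y + change y z
  change-triangle x y z with x ≟ z | x ≟ y | y ≟ z
  ... | yes _ | _ | _ = z≤n
  ... | no x≢z | yes refl | yes refl = ⊥-elim (x≢z refl)
  ... | no _ | yes _ | no _ = ≤-refl
  ... | no _ | no _ | _ = s≤s z≤n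

  runsFrom-triangle : ∀ x y zs → runsFrom x zs ≤ change x y + runsFrom y zs
  runsFrom-triangle x y [] = z≤n
  runsFrom-triangle x y (z ∷ zs) = begin
    change x z + runsFrom z zs                ≤⟨ +-monoˡ-≤ (runsFrom z zs) (change-triangle x y z) ⟩
    (change x y + change y z) + runsFrom z zs ≡⟨ +-assoc (change x y) (change y z) (runsFrom z zs) ⟩
    change x y + runsFrom y (z ∷ zs)          ∎
    where open ≤-Reasoning

  runsFrom-mono : ∀ x {xs ys} → xs ⊆ ys → runsFrom x xs ≤ runsFrom x ys
  runsFrom-mono x [] = z≤n
  runsFrom-mono x (_∷ʳ_ {ys = ys} y p) = ≤-trans (runsFrom-mono x p) (runsFrom-triangle x y ys)
  runsFrom-mono x (_∷_ {y = y} refl p) = +-monoʳ-≤ (change x y) (runsFrom-mono y p)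

  runs≤runsFrom : ∀ x xs → runs xs ≤ runsFrom x xs
  runs≤runsFrom x [] = z≤n
  runs≤runsFrom x (y ∷ ys) = m≤n+m (runsFrom y ys) (change x y)

  runs-mono : ∀ {xs ys} → xs ⊆ ys → runs xs ≤ runs ys
  runs-mono [] = z≤n
  runs-mono (_∷ʳ_ {ys = ys} y p) = ≤-trans (runs-mono p) (runs≤runsFrom y ys)
  runs-mono (_∷_ {y = y} refl p) = runsFrom-mono y p

  length-pow : ∀ v e → length (pow v e) ≡ e * length v
  length-pow v zero = refl
  length-pow v (suc e) = trans (length-++ v) (cong (length v +_) (length-pow v e))

  pow-length-≤ : ∀ v {e f} → e ≤ f → length (pow v e) ≤ length (pow v f)
  pow-length-≤ v {e} {f} e≤f = begin
    length (pow v e) ≡⟨ length-pow v e ⟩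
    e * length v     ≤⟨ *-monoˡ-≤ (length v) e≤f ⟩
    f * length v     ≡⟨ length-pow v f ⟨
    length (pow v f) ∎
    where open ≤-Reasoning

  pow-length-injective : ∀ {v} → ¬ v ≡ [] → ∀ e f →
                         length (pow v e) ≡ length (pow v f) → pow v e ≡ pow v f
  pow-length-injective {[]} v≢[] _ _ _ = ⊥-elim (v≢[] refl)
  pow-length-injective {v@(_ ∷ _)} _ e f eq =
    cong (pow v) (*-cancelʳ-≡ e f (length v) (trans (sym (length-pow v e)) (trans eq (length-pow v f))))

  nth-pow : ∀ x xs e {j} → j < e * length (x ∷ xs) →
            nth (pow (x ∷ xs) e) j ≡ nth (x ∷ xs) (j % length (x ∷ xs))
  nth-pow x xs (suc e) {j} j< with j <? length (x ∷ xs)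
  ... | yes j<n = trans (nth-++ˡ (x ∷ xs) _ j<n) (cong (nth (x ∷ xs)) (sym (m<n⇒m%n≡m j<n)))
  ... | no j≮n with k , refl ← m≤n⇒∃[o]m+o≡n (≮⇒≥ j≮n) = begin
    nth (pow (x ∷ xs) (suc e)) (n + k) ≡⟨ nth-++ʳ (x ∷ xs) _ k ⟩
    nth (pow (x ∷ xs) e) k             ≡⟨ nth-pow x xs e (+-cancelˡ-< n k _ j<) ⟩
    nth (x ∷ xs) (k % n)               ≡⟨ cong (nth (x ∷ xs)) ([m+n]%n≡m%n k n) ⟨
    nth (x ∷ xs) ((k + n) % n)         ≡⟨ cong (λ i → nth (x ∷ xs) (i % n)) (+-comm k n) ⟩
    nth (x ∷ xs) ((n + k) % n)         ∎
    where
    open ≡-Reasoning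
    n = length (x ∷ xs)

  omega-nth : ∀ x xs i → just (omega x xs i) ≡ nth (x ∷ xs) (i % length (x ∷ xs))
  omega-nth x xs i =
    trans (sym (nth-lookup (x ∷ xs) (fromℕ< i%n<n))) (cong (nth (x ∷ xs)) (toℕ-fromℕ< i%n<n))
    where
    i%n<n = m%n<n i (length (x ∷ xs))

  omega-pow : ∀ {y ys x xs} e → y ∷ ys ≡ pow (x ∷ xs) e → ∀ i → omega y ys i ≡ omega x xs i
  omega-pow {y} {ys} {x} {xs} e u≡ i = just-injective (begin
    just (omega y ys i)   ≡⟨ omega-nth y ys i ⟩
    nth u (i % m)         ≡⟨ cong (λ w → nth w (i % m)) u≡ ⟩
    nth (pow v e) (i % m) ≡⟨ nth-pow x xs e (subst (i % m <_) m≡en (m%n<n i m)) ⟩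
    nth v (i % m % n)     ≡⟨ cong (nth v) (m∣n⇒o%n%m≡o%m n m i (divides e m≡en)) ⟩
    nth v (i % n)         ≡⟨ omega-nth x xs i ⟨
    just (omega x xs i)   ∎)
    where
    open ≡-Reasoning
    u = y ∷ ys
    v = x ∷ xs
    m = length u
    n = length v
    m≡en : m ≡ e * n
    m≡en = trans (cong length u≡) (length-pow v e)

  LexLt-irrefl : ∀ {f g} → (∀ i → f i ≡ g i) → ¬ LexLt f g
  LexLt-irrefl f≗g (k , _ , fk<gk) = irrefl (f≗g k) fk<gk

  LexLt-asym : ∀ {f g} → LexLt f g → ¬ LexLt g f
  LexLt-asym (k , f≡g , fk<gk) (l , g≡f , gl<fl) with <-cmp k l
  ... | tri< k<l _ _ = irrefl (sym (g≡f k k<l)) fk<gk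
  ... | tri≈ _ refl _ = asym fk<gk gl<fl
  ... | tri> _ _ l<k = irrefl (sym (f≡g l l<k)) gl<fl

  OmegaLt-asym : ∀ {u v} → OmegaLt u v → ¬ OmegaLt v u
  OmegaLt-asym {_ ∷ _} {_ ∷ _} = LexLt-asym

  pow-¬OmegaLt : ∀ {r u v} e f → ¬ r ≡ [] → u ≡ pow r e → v ≡ pow r f → ¬ OmegaLt u v
  pow-¬OmegaLt {[]} _ _ r≢[] _ _ _ = r≢[] refl
  pow-¬OmegaLt {_ ∷ _} {_ ∷ _} {_ ∷ _} e f _ u≡ v≡ =
    LexLt-irrefl (λ i → trans (omega-pow e u≡ i) (sym (omega-pow f v≡ i)))

  -- Comparing lengths spares us the uniqueness of primitive roots.
  ⪯ω-antisym : ∀ {u v} → u ⪯ω v → v ⪯ω u → u ≡ v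
  ⪯ω-antisym (inj₁ (r , e , f , ((r≢[] , _) , refl) , (_ , refl) , e≤f))
             (inj₁ (s , f′ , e′ , (_ , v≡) , (_ , u≡) , f′≤e′)) =
    pow-length-injective r≢[] e f (≤-antisym (pow-length-≤ r e≤f) (begin
      length (pow r f)  ≡⟨ cong length v≡ ⟩
      length (pow s f′) ≤⟨ pow-length-≤ s f′≤e′ ⟩
      length (pow s e′) ≡⟨ cong length u≡ ⟨
      length (pow r e)  ∎))
    where open ≤-Reasoning
  ⪯ω-antisym (inj₁ (r , e , f , ((r≢[] , _) , u≡) , (_ , v≡) , _))
             (inj₂ (_ , _ , _ , _ , _ , _ , _ , v<u)) =
    ⊥-elim (pow-¬OmegaLt f e r≢[] v≡ u≡ v<u)
  ⪯ω-antisym (inj₂ (_ , _ , _ , _ , _ , _ , _ , u<v))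
             (inj₁ (r , f , e , ((r≢[] , _) , v≡) , (_ , u≡) , _)) =
    ⊥-elim (pow-¬OmegaLt e f r≢[] u≡ v≡ u<v)
  ⪯ω-antisym (inj₂ (_ , _ , _ , _ , _ , _ , _ , u<v))
             (inj₂ (_ , _ , _ , _ , _ , _ , _ , v<u)) =
    ⊥-elim (OmegaLt-asym u<v v<u)

  ebwt-⊆ : ∀ {W V eW eV} → Unique V → (∀ w → w ∈ V → w ∈ W) →
           IsEBWT W eW → IsEBWT V eV → eV ⊆ eW
  ebwt-⊆ {W} {V} V! V⊆W (LW , LW↭ , LW↑ , refl) (LV , LV↭ , LV↑ , refl)
    with C , W↭ ← Unique-⊆⇒↭-++ V! V⊆W =
    concatMap-⊆ lastChar (AllPairs-↭-++⇒⊆ ⪯ω-antisym LW↑ LV↑ LW↭LV++)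
    where
    open PermutationReasoning
    LW↭LV++ : LW ↭ LV ++ allRotations C
    LW↭LV++ = begin
      LW                               ↭⟨ LW↭ ⟩
      allRotations W                   ↭⟨ concatMap-↭ rotations W↭ ⟩
      allRotations (V ++ C)            ≡⟨ concatMap-++ rotations V C ⟩
      allRotations V ++ allRotations C ↭⟨ ++⁺ʳ (allRotations C) (↭-sym LV↭) ⟩
      LV ++ allRotations C             ∎

corollary2 : ∀ {a ℓ : Level} {Σ : Set a} {_<_ : Rel Σ ℓ}
               (sto : IsStrictTotalOrder _≡_ _<_)
               (A B : List (List Σ)) →
               Unique A → Unique B →
               All (λ w → ¬ (w ≡ [])) A → All (λ w → ¬ (w ≡ [])) B →
               (∀ w → w ∈ B → w ∈ A) →
               ∀ (eA eB : List Σ) →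
               Alphabet.IsEBWT sto A eA → Alphabet.IsEBWT sto B eB →
               Alphabet.runs sto eB ≤ Alphabet.runs sto eA
corollary2 sto A B _ B! _ _ B⊆A eA eB ebwtA ebwtB = runs-mono sto (ebwt-⊆ sto B! B⊆A ebwtA ebwtB)
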